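{- Let $\mathbf P=(P,\leq,{}',0,1)$ be an orthogonal lub-complete poset. Then the following are equivalent: (i) $\mathbf P$ is an orthocomplemented poset; (ii) for all $x,y\in P$, $x\leq y$ implies $x\rightarrow_S y=\{1\}$; (iii) for all $x,y\in P$, $x\leq y$ implies $x\rightarrow_D y=\{1\}$.
   Context: For a poset $(P,\leq)$ and $A\subseteq P$: $L(A)=\{x: x\leq a\ \forall a\in A\}$, $L(x,y)=L(\{x,y\})$; $\operatorname{Max}A$: maximal elements of $A$. A bounded poset $(P,\leq,{}',0,1)$ with antitone involution: $x\leq y\Rightarrow y'\leq x'$, $x''=x$. $x\perp y$ iff $x\leq y'$. Orthogonal: $x\perp y$ implies the supremum $x\vee y$ exists. Lub-complete: for every finite $M\subseteq P$ and lower bound $x$ of $M$ there is a maximal element of $L(M)$ above $x$. Orthocomplemented: $x\vee x'=1$ for all $x$. Sasaki implication: $x\rightarrow_S y=\{x'\vee a: a\in\operatorname{Max}L(x,y)\}$; Dishkant implication: $x\rightarrow_D y=y'\rightarrow_S x'=\{y\vee b: b\in\operatorname{Max}L(x',y')\}$. -}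

module Defs where

open import Level using (Level; _⊔_; suc)
open import Data.Product using (Σ; ∃; _×_; _,_)
open import Data.List using (List; _∷_; [])
open import Data.List.Membership.Propositional using (_∈_)
open import Relation.Binary.PropositionalEquality using (_≡_)
open import Relation.Binary.Structures using (IsPartialOrder)
open import Function.Bundles using (_⇔_)

record BoundedInvPoset (c ℓ : Level) : Set (Level.suc (c ⊔ ℓ)) where
  field
    Carrier : Set c
    _≤_     : Carrier → Carrier → Set ℓ
    isPartialOrder : IsPartialOrder _≡_ _≤_
    _′      : Carrier → Carrier
    𝟎 𝟏     : Carrier
    minimum : ∀ x → 𝟎 ≤ x
    maximum : ∀ x → x ≤ 𝟏
    antitone : ∀ {x y} → x ≤ y → (y ′) ≤ (x ′)
    involutive : ∀ x → ((x ′) ′) ≡ x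

  infix 4 _≤_
  infix 8 _′

  Subset : Set (Level.suc (c ⊔ ℓ))
  Subset = Carrier → Set (c ⊔ ℓ)

  _⊥_ : Carrier → Carrier → Set ℓ
  x ⊥ y = x ≤ (y ′)

  IsSup : Carrier → Carrier → Carrier → Set (c ⊔ ℓ)
  IsSup x y s = (x ≤ s) × (y ≤ s) × (∀ z → x ≤ z → y ≤ z → s ≤ z)

  IsLowerBoundOf : List Carrier → Carrier → Set (c ⊔ ℓ)
  IsLowerBoundOf M z = ∀ a → a ∈ M → z ≤ a

  InL2 : Carrier → Carrier → Carrier → Set ℓ
  InL2 x y z = (z ≤ x) × (z ≤ y)

  InMaxL2 : Carrier → Carrier → Carrier → Set (c ⊔ ℓ)
  InMaxL2 x y a = InL2 x y a × (∀ z → InL2 x y z → a ≤ z → z ≡ a)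

  InMaxL : List Carrier → Carrier → Set (c ⊔ ℓ)
  InMaxL M a = IsLowerBoundOf M a × (∀ z → IsLowerBoundOf M z → a ≤ z → z ≡ a)

  Orthogonal : Set (c ⊔ ℓ)
  Orthogonal = ∀ x y → x ⊥ y → ∃ λ s → IsSup x y s

  LubComplete : Set (c ⊔ ℓ)
  LubComplete = ∀ (M : List Carrier) x → IsLowerBoundOf M x →
                  ∃ λ a → InMaxL M a × (x ≤ a)

  Orthocomplemented : Set (c ⊔ ℓ)
  Orthocomplemented = ∀ x → IsSup x (x ′) 𝟏

  -- Sasaki implication x →S y = { x' ∨ a : a ∈ Max L(x,y) }
  -- (x' ∨ a exists in an orthogonal poset since a ≤ x; membership is
  --  "z is the supremum of x' and some a ∈ Max L(x,y)")
  _→S_ : Carrier → Carrier → Subset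
  (x →S y) z = ∃ λ a → InMaxL2 x y a × IsSup (x ′) a z

  -- Dishkant implication x →D y = y' →S x' = { y ∨ b : b ∈ Max L(x',y') }
  _→D_ : Carrier → Carrier → Subset
  x →D y = (y ′) →S (x ′)

  IsSingleton𝟏 : Subset → Set (c ⊔ ℓ)
  IsSingleton𝟏 A = ∀ z → A z ⇔ (z ≡ 𝟏)

-- When x ≤ y, the set Max L(x,y) is just {x}, so x →S y is the single supremum x′ ∨ x,
-- which is 1 for all x exactly when P is orthocomplemented.  Since x ↦ x′ is an antitone
-- involution, x →D y = y′ →S x′ ranges over all Sasaki implications of comparable pairs.
module Submission where

open import Defs
open import Level using (_⊔_)
open import Data.Product using (_×_; _,_)
open import Function.Bundles using (_⇔_; mk⇔; Equivalence)
import Function.Properties.Equivalence as ⇔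
open import Relation.Binary.PropositionalEquality using (_≡_; refl; sym; subst₂)
open import Relation.Binary.Structures using (IsPartialOrder)

module _ {c ℓ} (P : BoundedInvPoset c ℓ) where
  open BoundedInvPoset P
  open IsPartialOrder isPartialOrder using (antisym) renaming (refl to ≤-refl)

  SasakiTrivialOn≤ : Set (c ⊔ ℓ)
  SasakiTrivialOn≤ = ∀ x y → x ≤ y → IsSingleton𝟏 (x →S y)

  DishkantTrivialOn≤ : Set (c ⊔ ℓ)
  DishkantTrivialOn≤ = ∀ x y → x ≤ y → IsSingleton𝟏 (x →D y)

  IsSup-comm : ∀ {x y s} → IsSup x y s → IsSup y x s
  IsSup-comm (x≤s , y≤s , least) = y≤s , x≤s , λ z y≤z x≤z → least z x≤z y≤z

  IsSup-unique : ∀ {x y s t} → IsSup x y s → IsSup x y t → s ≡ t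
  IsSup-unique (x≤s , y≤s , s-least) (x≤t , y≤t , t-least) =
    antisym (s-least _ x≤t y≤t) (t-least _ x≤s y≤s)

  InMaxL2-≤ : ∀ {x y} → x ≤ y → InMaxL2 x y x
  InMaxL2-≤ x≤y = (≤-refl , x≤y) , λ z (z≤x , _) x≤z → antisym z≤x x≤z

  InMaxL2-≤⇒≡ : ∀ {x y a} → x ≤ y → InMaxL2 x y a → a ≡ x
  InMaxL2-≤⇒≡ x≤y ((a≤x , _) , maximal) = sym (maximal _ (≤-refl , x≤y) a≤x)

  →S-≤ : ∀ {x y} → x ≤ y → ∀ z → (x →S y) z ⇔ IsSup x (x ′) z
  →S-≤ {x} {y} x≤y z = mk⇔ to from
    where
    to : (x →S y) z → IsSup x (x ′) z
    to (a , a-max , sup) with InMaxL2-≤⇒≡ x≤y a-max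
    ... | refl = IsSup-comm sup

    from : IsSup x (x ′) z → (x →S y) z
    from sup = x , InMaxL2-≤ x≤y , IsSup-comm sup

  orthocomplemented⇔SasakiTrivialOn≤ : Orthocomplemented ⇔ SasakiTrivialOn≤
  orthocomplemented⇔SasakiTrivialOn≤ = mk⇔ to from
    where
    to : Orthocomplemented → SasakiTrivialOn≤
    to oc x y x≤y z = mk⇔
      (λ z∈ → IsSup-unique (Equivalence.to (→S-≤ x≤y z) z∈) (oc x))
      (λ { refl → Equivalence.from (→S-≤ x≤y 𝟏) (oc x) })

    from : SasakiTrivialOn≤ → Orthocomplemented
    from trivial x =
      Equivalence.to (→S-≤ ≤-refl 𝟏) (Equivalence.from (trivial x x ≤-refl 𝟏) refl)

  SasakiTrivialOn≤⇔DishkantTrivialOn≤ : SasakiTrivialOn≤ ⇔ DishkantTrivialOn≤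
  SasakiTrivialOn≤⇔DishkantTrivialOn≤ = mk⇔ to from
    where
    to : SasakiTrivialOn≤ → DishkantTrivialOn≤
    to trivial x y x≤y = trivial (y ′) (x ′) (antitone x≤y)

    from : DishkantTrivialOn≤ → SasakiTrivialOn≤
    from trivial x y x≤y =
      subst₂ (λ u v → IsSingleton𝟏 (u →S v)) (involutive x) (involutive y)
        (trivial (y ′) (x ′) (antitone x≤y))

-- Orthogonality and lub-completeness only guarantee that the implications are
-- non-empty; membership is stated here via an explicit supremum.
theorem7 : ∀ {c ℓ} (P : BoundedInvPoset c ℓ) →
    let open BoundedInvPoset P in
    Orthogonal → LubComplete →
    (Orthocomplemented ⇔ (∀ x y → x ≤ y → IsSingleton𝟏 (x →S y)))
    × (Orthocomplemented ⇔ (∀ x y → x ≤ y → IsSingleton𝟏 (x →D y)))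
theorem7 P _ _ =
    orthocomplemented⇔SasakiTrivialOn≤ P
  , ⇔.trans (orthocomplemented⇔SasakiTrivialOn≤ P) (SasakiTrivialOn≤⇔DishkantTrivialOn≤ P)
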